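{- Let $G$ and $H$ be connected graphs, each of order at least $2$, with $\mu_{\rm it}(G)\ge 1$ and $\mu_{\rm it}(H)\ge 1$. Then $$\max\{\mu_{\rm it}(H)\mu_{\rm t}(G),\ \mu_{\rm it}(G)\mu_{\rm t}(H)\}\le \mu_{\rm t}(G\,\square\,H)\le \min\{\mu_{\rm t}(G)\,n(H),\ \mu_{\rm t}(H)\,n(G)\}.$$
   Context: All graphs are finite, simple and connected; $n(G)$ is the order of $G$. The Cartesian product $G\,\square\,H$ has vertex set $V(G)\times V(H)$, with $(g,h)$ adjacent to $(g',h')$ iff either $gg'\in E(G)$ and $h=h'$, or $g=g'$ and $hh'\in E(H)$. For $X\subseteq V(G)$, two vertices $x,y$ are $X$-visible if there is a shortest $x,y$-path $P$ with $V(P)\cap X\subseteq\{x,y\}$; $X$ is a total mutual-visibility set if every pair of vertices of $G$ is $X$-visible. $\mu_{\rm t}(G)$ is the largest cardinality of a total mutual-visibility set of $G$, and $\mu_{\rm it}(G)$ (independent total mutual-visibility number) is the largest cardinality of a total mutual-visibility set of $G$ that is an independent set. -}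

module Defs where

open import Data.Nat using (ℕ; zero; suc; _≤_)
open import Data.Bool using (Bool; true; false; T; _∧_; _∨_)
open import Data.Fin using (Fin; remQuot)
open import Data.Fin.Properties using (_≟_)
open import Data.Fin.Subset using (Subset; _∈_; ∣_∣)
open import Data.List using (List; []; _∷_)
open import Data.List.Membership.Propositional renaming (_∈_ to _∈ₗ_)
open import Data.Product using (Σ; _×_; _,_; ∃)
open import Data.Sum using (_⊎_)
open import Relation.Nullary using (¬_)
open import Relation.Nullary.Decidable using (⌊_⌋)
open import Relation.Binary.PropositionalEquality using (_≡_)

record Graph : Set where
  constructor mkGraph
  field
    n   : ℕ
    adj : Fin n → Fin n → Bool
open Graph public

order : Graph → ℕ
order = Graph.n

Vertex : Graph → Set
Vertex G = Fin (n G)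

Edge : (G : Graph) → Vertex G → Vertex G → Set
Edge G u v = T (adj G u v)

IsSimple : Graph → Set
IsSimple G = (∀ u v → adj G u v ≡ adj G v u) × (∀ u → adj G u u ≡ false)

data Walk (G : Graph) : Vertex G → Vertex G → Set where
  []  : ∀ {x} → Walk G x x
  _∷_ : ∀ {x y z} → Edge G x y → Walk G y z → Walk G x z

walkLength : ∀ {G x y} → Walk G x y → ℕ
walkLength []      = zero
walkLength (_ ∷ w) = suc (walkLength w)

walkVertices : ∀ {G x y} → Walk G x y → List (Vertex G)
walkVertices {x = x} []      = x ∷ []
walkVertices {x = x} (_ ∷ w) = x ∷ walkVertices w

Connected : Graph → Set
Connected G = ∀ (x y : Vertex G) → Walk G x y

-- a shortest x,y-path (any walk of minimum length is a path)
IsShortest : ∀ {G x y} → Walk G x y → Set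
IsShortest {G} {x} {y} w = ∀ (w' : Walk G x y) → walkLength w ≤ walkLength w'

Visible : (G : Graph) → Subset (n G) → Vertex G → Vertex G → Set
Visible G X x y =
  Σ (Walk G x y) λ P → IsShortest P ×
    (∀ v → v ∈ₗ walkVertices P → v ∈ X → (v ≡ x) ⊎ (v ≡ y))

IsTotalMutualVisibility : (G : Graph) → Subset (n G) → Set
IsTotalMutualVisibility G X = ∀ (x y : Vertex G) → Visible G X x y

IsIndependent : (G : Graph) → Subset (n G) → Set
IsIndependent G X = ∀ u v → u ∈ X → v ∈ X → ¬ Edge G u v

IsMuT : Graph → ℕ → Set
IsMuT G k =
  (Σ (Subset (n G)) λ X → IsTotalMutualVisibility G X × ∣ X ∣ ≡ k) ×
  (∀ X → IsTotalMutualVisibility G X → ∣ X ∣ ≤ k)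

IsMuIt : Graph → ℕ → Set
IsMuIt G k =
  (Σ (Subset (n G)) λ X → IsTotalMutualVisibility G X × IsIndependent G X × ∣ X ∣ ≡ k) ×
  (∀ X → IsTotalMutualVisibility G X → IsIndependent G X → ∣ X ∣ ≤ k)

-- Cartesian product G □ H on Fin (n G * n H), vertex i ↔ remQuot i = (g , h)
_□_ : Graph → Graph → Graph
G □ H = mkGraph (n G Data.Nat.* n H) a
  where
  a : Fin (n G Data.Nat.* n H) → Fin (n G Data.Nat.* n H) → Bool
  a i j with remQuot {n G} (n H) i | remQuot {n G} (n H) j
  ... | (g , h) | (g' , h') =
    (adj G g g' ∧ ⌊ h ≟ h' ⌋) ∨ (⌊ g ≟ g' ⌋ ∧ adj H h h')

-- If X is a total mutual-visibility set of G and Y an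
-- independent one of H, then X × Y is one of G □ H. Distances in G □ H are sums of distances in the
-- factors, so between (g, h) and (g′, h′) a shortest path may go along a shortest h,h′-path Q in the layer
-- {g} × H up to a vertex q, then along a shortest g,g′-path in G × {q}, and then along the rest of Q in
-- {g′} × H. Choosing q so that Y meets the first part of Q only in h and the second only in h′ (possible
-- because Y is independent) makes the whole path avoid X × Y internally.
-- For the upper bound, each layer {h | (g, h) ∈ Z} of a total mutual-visibility set Z of G □ H is one of H,
-- since a shortest path between two vertices of {g} × H never leaves it; summing over g gives n(G) μt(H).
-- The other two bounds follow from G □ H ≅ H □ G.

module Submission where

open import Data.Nat.Properties hiding (_≟_)
open import Algebra.Properties.CommutativeSemigroup +-commutativeSemigroup using (x∙yz≈y∙xz)
open import Algebra.Properties.Semiring.Sum +-*-semiring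
  using (sum-syntax; sum-cong-≗; ∑-permute; *-distribˡ-sum; *-distribʳ-sum)
open import Data.Bool using (Bool; true; false; T; _∧_; _∨_)
open import Data.Bool.Properties using (T-∧; T-∨)
open import Data.Empty using (⊥-elim)
open import Data.Fin using (Fin; zero; suc; _↑ˡ_; _↑ʳ_; combine; quotRem; quotient; remainder)
open import Data.Fin.Permutation using (Permutation; _⟨$⟩ʳ_)
open import Data.Fin.Properties using (_≟_; remQuot-combine; combine-remQuot; *↔×)
open import Data.Fin.Subset using (Subset; _∈_; _∩_; ∣_∣)
open import Data.Fin.Subset.Properties using (_∈?_; x∈p∩q⁻)
open import Data.List.Membership.Propositional renaming (_∈_ to _∈ₗ_)
open import Data.List.Relation.Unary.Any using (here; there)
open import Data.Nat using (ℕ; zero; suc; _+_; _*_; _≤_; _⊔_; _⊓_; z≤n; s≤s)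
open import Data.Product using (Σ; ∃; _×_; _,_; proj₁; proj₂; map₁; map₂)
open import Data.Product.Algebra using (×-comm)
open import Data.Sum using (_⊎_; inj₁; inj₂)
open import Data.Vec using ([]; _∷_; lookup; tabulate)
open import Data.Vec.Properties using (lookup∘tabulate; lookup-zipWith; []=⇒lookup; lookup⇒[]=)
open import Function using (_∘_; _⇔_; mk⇔; Equivalence)
open import Function.Properties.Inverse using (↔-trans; ↔-sym)
open import Relation.Binary.PropositionalEquality
open import Relation.Nullary using (Dec; yes; no; ¬_)
open import Relation.Nullary.Decidable using (⌊_⌋; toWitness; fromWitness)

open import Defs

boolToℕ : Bool → ℕ
boolToℕ true  = 1
boolToℕ false = 0

boolToℕ-∧ : ∀ a b → boolToℕ (a ∧ b) ≡ boolToℕ a * boolToℕ b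
boolToℕ-∧ true  b = sym (*-identityˡ (boolToℕ b))
boolToℕ-∧ false b = refl

∑-↑ : ∀ m n (f : Fin (m + n) → ℕ) →
      ∑[ i < m + n ] f i ≡ ∑[ i < m ] f (i ↑ˡ n) + ∑[ j < n ] f (m ↑ʳ j)
∑-↑ zero    n f = refl
∑-↑ (suc m) n f = trans (cong (f zero +_) (∑-↑ m n (f ∘ suc))) (sym (+-assoc (f zero) _ _))

∑-combine : ∀ m n (f : Fin (m * n) → ℕ) →
            ∑[ i < m * n ] f i ≡ ∑[ g < m ] ∑[ h < n ] f (combine g h)
∑-combine zero    n f = refl
∑-combine (suc m) n f =
  trans (∑-↑ n (m * n) f) (cong (∑[ h < n ] f (h ↑ˡ m * n) +_) (∑-combine m n (f ∘ (n ↑ʳ_))))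

∑-≤-* : ∀ n {c} (f : Fin n → ℕ) → (∀ i → f i ≤ c) → ∑[ i < n ] f i ≤ n * c
∑-≤-* zero    f f≤c = z≤n
∑-≤-* (suc n) f f≤c = +-mono-≤ (f≤c zero) (∑-≤-* n (f ∘ suc) (f≤c ∘ suc))

∣p∣≡∑ : ∀ {n} (p : Subset n) → ∣ p ∣ ≡ ∑[ i < n ] boolToℕ (lookup p i)
∣p∣≡∑ []          = refl
∣p∣≡∑ (true  ∷ p) = cong suc (∣p∣≡∑ p)
∣p∣≡∑ (false ∷ p) = ∣p∣≡∑ p

preimage : ∀ {m n} → (Fin m → Fin n) → Subset n → Subset m
preimage f p = tabulate (lookup p ∘ f)

lookup-preimage : ∀ {m n} (f : Fin m → Fin n) (p : Subset n) i → lookup (preimage f p) i ≡ lookup p (f i)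
lookup-preimage f p = lookup∘tabulate (lookup p ∘ f)

∈-preimage⁻ : ∀ {m n} (f : Fin m → Fin n) (p : Subset n) {i} → i ∈ preimage f p → f i ∈ p
∈-preimage⁻ f p {i} i∈ = lookup⇒[]= (f i) p (trans (sym (lookup-preimage f p i)) ([]=⇒lookup i∈))

∣preimage∣ : ∀ {m n} (π : Permutation m n) (p : Subset n) → ∣ preimage (π ⟨$⟩ʳ_) p ∣ ≡ ∣ p ∣
∣preimage∣ {m} {n} π p = begin
  ∣ preimage (π ⟨$⟩ʳ_) p ∣                   ≡⟨ ∣p∣≡∑ (preimage (π ⟨$⟩ʳ_) p) ⟩
  ∑[ i < m ] boolToℕ (lookup (preimage (π ⟨$⟩ʳ_) p) i)
    ≡⟨ sum-cong-≗ (cong boolToℕ ∘ lookup-preimage (π ⟨$⟩ʳ_) p) ⟩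
  ∑[ i < m ] boolToℕ (lookup p (π ⟨$⟩ʳ i))   ≡⟨ ∑-permute (boolToℕ ∘ lookup p) π ⟨
  ∑[ i < n ] boolToℕ (lookup p i)            ≡⟨ ∣p∣≡∑ p ⟨
  ∣ p ∣                                       ∎
  where open ≡-Reasoning

layer : ∀ {m n} → Subset (m * n) → Fin m → Subset n
layer p g = preimage (combine g) p

∣p∣≡∑∣layer∣ : ∀ m {n} (p : Subset (m * n)) → ∣ p ∣ ≡ ∑[ g < m ] ∣ layer p g ∣
∣p∣≡∑∣layer∣ m {n} p = begin
  ∣ p ∣                                                   ≡⟨ ∣p∣≡∑ p ⟩
  ∑[ i < m * n ] boolToℕ (lookup p i)                     ≡⟨ ∑-combine m n (boolToℕ ∘ lookup p) ⟩
  ∑[ g < m ] ∑[ h < n ] boolToℕ (lookup p (combine g h))  ≡⟨ sum-cong-≗ {m} ∣layer∣≡∑ ⟨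
  ∑[ g < m ] ∣ layer p g ∣                                ∎
  where
  open ≡-Reasoning
  ∣layer∣≡∑ : ∀ g → ∣ layer p g ∣ ≡ ∑[ h < n ] boolToℕ (lookup p (combine g h))
  ∣layer∣≡∑ g = trans (∣p∣≡∑ (layer p g)) (sum-cong-≗ (cong boolToℕ ∘ lookup-preimage (combine g) p))

_×ˢ_ : ∀ {m n} → Subset m → Subset n → Subset (m * n)
_×ˢ_ {m} {n} p q = preimage (quotient n) p ∩ preimage (remainder {m} n) q

lookup-×ˢ : ∀ {m n} (p : Subset m) (q : Subset n) g h →
            lookup (p ×ˢ q) (combine g h) ≡ lookup p g ∧ lookup q h
lookup-×ˢ {m} {n} p q g h = begin
  lookup (p ×ˢ q) (combine g h)
    ≡⟨ lookup-zipWith _∧_ (combine g h) (preimage (quotient n) p) (preimage (remainder {m} n) q) ⟩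
  lookup (preimage (quotient n) p) (combine g h) ∧ lookup (preimage (remainder {m} n) q) (combine g h)
    ≡⟨ cong₂ _∧_ (lookup-preimage (quotient n) p (combine g h))
                 (lookup-preimage (remainder {m} n) q (combine g h)) ⟩
  lookup p (quotient n (combine g h)) ∧ lookup q (remainder {m} n (combine g h))
    ≡⟨ cong (λ (g′ , h′) → lookup p g′ ∧ lookup q h′) (remQuot-combine g h) ⟩
  lookup p g ∧ lookup q h ∎
  where open ≡-Reasoning

∣p×ˢq∣ : ∀ {m n} (p : Subset m) (q : Subset n) → ∣ p ×ˢ q ∣ ≡ ∣ p ∣ * ∣ q ∣
∣p×ˢq∣ {m} {n} p q = begin
  ∣ p ×ˢ q ∣
    ≡⟨ ∣p∣≡∑ (p ×ˢ q) ⟩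
  ∑[ i < m * n ] boolToℕ (lookup (p ×ˢ q) i)
    ≡⟨ ∑-combine m n (boolToℕ ∘ lookup (p ×ˢ q)) ⟩
  ∑[ g < m ] ∑[ h < n ] boolToℕ (lookup (p ×ˢ q) (combine g h))
    ≡⟨ sum-cong-≗ (λ g → sum-cong-≗ (λ h →
         trans (cong boolToℕ (lookup-×ˢ p q g h)) (boolToℕ-∧ (lookup p g) (lookup q h)))) ⟩
  ∑[ g < m ] ∑[ h < n ] (boolToℕ (lookup p g) * boolToℕ (lookup q h))
    ≡⟨ sum-cong-≗ (λ g → *-distribˡ-sum (boolToℕ (lookup p g)) (boolToℕ ∘ lookup q)) ⟨
  ∑[ g < m ] (boolToℕ (lookup p g) * ∑[ h < n ] boolToℕ (lookup q h))
    ≡⟨ *-distribʳ-sum (∑[ h < n ] boolToℕ (lookup q h)) (boolToℕ ∘ lookup p) ⟨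
  (∑[ g < m ] boolToℕ (lookup p g)) * (∑[ h < n ] boolToℕ (lookup q h))
    ≡⟨ cong₂ _*_ (∣p∣≡∑ p) (∣p∣≡∑ q) ⟨
  ∣ p ∣ * ∣ q ∣ ∎
  where open ≡-Reasoning

∈-×ˢ⁻ : ∀ {m n} (p : Subset m) (q : Subset n) {g h} → combine g h ∈ p ×ˢ q → g ∈ p × h ∈ q
∈-×ˢ⁻ {m} {n} p q {g} {h} gh∈ with x∈p∩q⁻ (preimage (quotient n) p) (preimage (remainder {m} n) q) gh∈
... | g∈ , h∈ =
  subst (_∈ p) (cong proj₁ (remQuot-combine g h)) (∈-preimage⁻ (quotient n) p g∈) ,
  subst (_∈ q) (cong proj₂ (remQuot-combine g h)) (∈-preimage⁻ (remainder {m} n) q h∈)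

module _ {K : Graph} where

  start∈ : ∀ {x y} (w : Walk K x y) → x ∈ₗ walkVertices w
  start∈ []      = here refl
  start∈ (_ ∷ _) = here refl

  end∈ : ∀ {x y} (w : Walk K x y) → y ∈ₗ walkVertices w
  end∈ []      = here refl
  end∈ (_ ∷ w) = there (end∈ w)

  infixr 5 _++ʷ_
  _++ʷ_ : ∀ {x y z} → Walk K x y → Walk K y z → Walk K x z
  []      ++ʷ w′ = w′
  (e ∷ w) ++ʷ w′ = e ∷ (w ++ʷ w′)

  length-++ʷ : ∀ {x y z} (w : Walk K x y) (w′ : Walk K y z) →
               walkLength (w ++ʷ w′) ≡ walkLength w + walkLength w′
  length-++ʷ []      w′ = refl
  length-++ʷ (e ∷ w) w′ = cong suc (length-++ʷ w w′)

  ∈-++ʷ⁻ : ∀ {x y z v} (w : Walk K x y) (w′ : Walk K y z) →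
           v ∈ₗ walkVertices (w ++ʷ w′) → v ∈ₗ walkVertices w ⊎ v ∈ₗ walkVertices w′
  ∈-++ʷ⁻ []      w′ v∈          = inj₂ v∈
  ∈-++ʷ⁻ (e ∷ w) w′ (here v≡x)  = inj₁ (here v≡x)
  ∈-++ʷ⁻ (e ∷ w) w′ (there v∈) with ∈-++ʷ⁻ w w′ v∈
  ... | inj₁ v∈w  = inj₁ (there v∈w)
  ... | inj₂ v∈w′ = inj₂ v∈w′

  walkLength-subst₂ : ∀ {x y x′ y′} (x≡x′ : x ≡ x′) (y≡y′ : y ≡ y′) (w : Walk K x y) →
                      walkLength (subst₂ (Walk K) x≡x′ y≡y′ w) ≡ walkLength w
  walkLength-subst₂ refl refl w = refl

  suffix : ∀ {x y v} (w : Walk K x y) → v ∈ₗ walkVertices w →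
           Σ (Walk K v y) λ w′ → walkLength w′ ≤ walkLength w
  suffix []      (here refl) = [] , z≤n
  suffix (e ∷ w) (here refl) = e ∷ w , ≤-refl
  suffix (e ∷ w) (there v∈) with suffix w v∈
  ... | w′ , w′≤w = w′ , m≤n⇒m≤1+n w′≤w

  start∉tail : ∀ {x y z} {e : Edge K x y} {w : Walk K y z} →
               IsShortest (e ∷ w) → ¬ (x ∈ₗ walkVertices w)
  start∉tail {w = w} shortest x∈w with suffix w x∈w
  ... | w′ , w′≤w = 1+n≰n (≤-trans (shortest w′) w′≤w)

module _ {K L : Graph} (f : Vertex K → Vertex L) (f-edge : ∀ {x y} → Edge K x y → Edge L (f x) (f y)) where

  mapʷ : ∀ {x y} → Walk K x y → Walk L (f x) (f y)
  mapʷ []      = []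
  mapʷ (e ∷ w) = f-edge e ∷ mapʷ w

  length-mapʷ : ∀ {x y} (w : Walk K x y) → walkLength (mapʷ w) ≡ walkLength w
  length-mapʷ []      = refl
  length-mapʷ (e ∷ w) = cong suc (length-mapʷ w)

  ∈-mapʷ⁻ : ∀ {x y v} (w : Walk K x y) → v ∈ₗ walkVertices (mapʷ w) →
            ∃ λ u → u ∈ₗ walkVertices w × v ≡ f u
  ∈-mapʷ⁻ []      (here v≡fx) = _ , here refl , v≡fx
  ∈-mapʷ⁻ (e ∷ w) (here v≡fx) = _ , here refl , v≡fx
  ∈-mapʷ⁻ (e ∷ w) (there v∈) with ∈-mapʷ⁻ w v∈
  ... | u , u∈w , v≡fu = u , there u∈w , v≡fu

InteriorAvoids : (K : Graph) → Subset (n K) → ∀ {x y} → Walk K x y → Set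
InteriorAvoids K X {x} {y} P = ∀ v → v ∈ₗ walkVertices P → v ∈ X → v ≡ x ⊎ v ≡ y

module _ {K L : Graph}
         (f : Vertex K → Vertex L) (f-edge : ∀ {x y} → Edge K x y → Edge L (f x) (f y))
         (r : Vertex L → Vertex K) (r-edge : ∀ {x y} → Edge L x y → Edge K (r x) (r y))
         (r∘f : ∀ x → r (f x) ≡ x) where

  visible-map : ∀ {X x y} → Visible K X x y → Visible L (preimage r X) (f x) (f y)
  visible-map {X} {x} {y} (P , P-shortest , P-avoids) = mapʷ f f-edge P , shortest , avoids
    where
    shortest : IsShortest (mapʷ f f-edge P)
    shortest W = begin
      walkLength (mapʷ f f-edge P)                                ≡⟨ length-mapʷ f f-edge P ⟩
      walkLength P                                                ≤⟨ P-shortest W′ ⟩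
      walkLength W′                                               ≡⟨ walkLength-subst₂ (r∘f x) (r∘f y) _ ⟩
      walkLength (mapʷ r r-edge W)                                ≡⟨ length-mapʷ r r-edge W ⟩
      walkLength W                                                ∎
      where
      open ≤-Reasoning
      W′ : Walk K x y
      W′ = subst₂ (Walk K) (r∘f x) (r∘f y) (mapʷ r r-edge W)
    avoids : InteriorAvoids L (preimage r X) (mapʷ f f-edge P)
    avoids v v∈ v∈X′ with ∈-mapʷ⁻ f f-edge P v∈
    ... | u , u∈P , refl with P-avoids u u∈P (subst (_∈ X) (r∘f u) (∈-preimage⁻ r X v∈X′))
    ... | inj₁ u≡x = inj₁ (cong f u≡x)
    ... | inj₂ u≡y = inj₂ (cong f u≡y)

  isTotalMutualVisibility-preimage : (∀ y → f (r y) ≡ y) → ∀ {X} →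
    IsTotalMutualVisibility K X → IsTotalMutualVisibility L (preimage r X)
  isTotalMutualVisibility-preimage f∘r X-tmv a b =
    subst₂ (Visible L _) (f∘r a) (f∘r b) (visible-map (X-tmv (r a) (r b)))

record Split (K : Graph) (Y : Subset (n K)) {x y} (Q : Walk K x y) : Set where
  field
    {middle}     : Vertex K
    front        : Walk K x middle
    back         : Walk K middle y
    length-split : walkLength front + walkLength back ≡ walkLength Q
    front-avoids : ∀ v → v ∈ₗ walkVertices front → v ∈ Y → v ≡ x
    back-avoids  : ∀ v → v ∈ₗ walkVertices back → v ∈ Y → v ≡ y

-- For a single edge, independence of Y leaves an endpoint outside Y at which to split.
split-shortest : ∀ {K Y x y} {Q : Walk K x y} → IsIndependent K Y → IsShortest Q → InteriorAvoids K Y Q →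
                 Split K Y Q
split-shortest {Q = []} _ _ _ = record
  { front = [] ; back = [] ; length-split = refl
  ; front-avoids = λ { v (here refl) _ → refl } ; back-avoids = λ { v (here refl) _ → refl } }
split-shortest {K} {Y} {x} {y} {e ∷ []} Y-independent _ _ with y ∈? Y
... | no y∉Y = record
  { front = e ∷ [] ; back = [] ; length-split = refl
  ; front-avoids = λ { v (here refl) _ → refl ; v (there (here refl)) v∈Y → ⊥-elim (y∉Y v∈Y) }
  ; back-avoids = λ { v (here refl) _ → refl } }
... | yes y∈Y = record
  { front = [] ; back = e ∷ [] ; length-split = refl
  ; front-avoids = λ { v (here refl) _ → refl }
  ; back-avoids = λ { v (here refl) v∈Y → ⊥-elim (Y-independent x y v∈Y y∈Y e)
                    ; v (there (here refl)) _ → refl } }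
split-shortest {K} {Y} {x} {y} {e ∷ e′ ∷ W} _ Q-shortest Q-avoids = record
  { front = e ∷ [] ; back = e′ ∷ W ; length-split = refl
  ; front-avoids = front-avoids ; back-avoids = back-avoids }
  where
  back-avoids : ∀ v → v ∈ₗ walkVertices {K} (e′ ∷ W) → v ∈ Y → v ≡ y
  back-avoids v v∈ v∈Y with Q-avoids v (there v∈) v∈Y
  ... | inj₁ refl = ⊥-elim (start∉tail {K} {e = e} {w = e′ ∷ W} Q-shortest v∈)
  ... | inj₂ v≡y  = v≡y
  front-avoids : ∀ v → v ∈ₗ walkVertices {K} (e ∷ []) → v ∈ Y → v ≡ x
  front-avoids v (here v≡x)         _   = v≡x
  front-avoids v (there (here refl)) v∈Y with back-avoids v (here refl) v∈Y
  ... | refl with Q-shortest (e ∷ [])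
  ... | s≤s ()

T-□-adjacency : ∀ {p q} {P : Set p} {Q : Set q} a b (P? : Dec P) (Q? : Dec Q) →
                T ((a ∧ ⌊ P? ⌋) ∨ (⌊ Q? ⌋ ∧ b)) ⇔ ((T a × P) ⊎ (Q × T b))
T-□-adjacency {P = P} {Q} a b P? Q? = mk⇔ to from
  where
  to : T ((a ∧ ⌊ P? ⌋) ∨ (⌊ Q? ⌋ ∧ b)) → (T a × P) ⊎ (Q × T b)
  to t with Equivalence.to T-∨ t
  ... | inj₁ t₁ = let (ta , tP) = Equivalence.to T-∧ t₁ in inj₁ (ta , toWitness tP)
  ... | inj₂ t₂ = let (tQ , tb) = Equivalence.to T-∧ t₂ in inj₂ (toWitness tQ , tb)
  from : (T a × P) ⊎ (Q × T b) → T ((a ∧ ⌊ P? ⌋) ∨ (⌊ Q? ⌋ ∧ b))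
  from (inj₁ (ta , p)) = Equivalence.from T-∨ (inj₁ (Equivalence.from T-∧ (ta , fromWitness p)))
  from (inj₂ (q , tb)) = Equivalence.from (T-∨ {a ∧ ⌊ P? ⌋}) (inj₂ (Equivalence.from T-∧ (fromWitness q , tb)))

module _ (G H : Graph) where

  fstᵛ : Vertex (G □ H) → Vertex G
  fstᵛ = quotient (n H)

  sndᵛ : Vertex (G □ H) → Vertex H
  sndᵛ = remainder {n G} (n H)

  fstᵛ-combine : ∀ g h → fstᵛ (combine g h) ≡ g
  fstᵛ-combine g h = cong proj₁ (remQuot-combine {n G} {n H} g h)

  sndᵛ-combine : ∀ g h → sndᵛ (combine g h) ≡ h
  sndᵛ-combine g h = cong proj₂ (remQuot-combine {n G} {n H} g h)

  combine-fstᵛ-sndᵛ : ∀ i → combine (fstᵛ i) (sndᵛ i) ≡ i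
  combine-fstᵛ-sndᵛ = combine-remQuot {n G} (n H)

  ProductEdge : Vertex (G □ H) → Vertex (G □ H) → Set
  ProductEdge i j = (Edge G (fstᵛ i) (fstᵛ j) × sndᵛ i ≡ sndᵛ j)
                  ⊎ (fstᵛ i ≡ fstᵛ j × Edge H (sndᵛ i) (sndᵛ j))

  -- remQuot unfolds to quotRem, which is the term the adjacency of G □ H has to be abstracted over.
  □-edge : ∀ i j → Edge (G □ H) i j ⇔ ProductEdge i j
  □-edge i j with quotRem {n G} (n H) i | quotRem {n G} (n H) j
  ... | h , g | h′ , g′ = T-□-adjacency (adj G g g′) (adj H h h′) (h ≟ h′) (g ≟ g′)

  combine-edgeˡ : ∀ h {g g′} → Edge G g g′ → Edge (G □ H) (combine g h) (combine g′ h)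
  combine-edgeˡ h {g} {g′} e = Equivalence.from (□-edge _ _) (inj₁
    ( subst₂ (Edge G) (sym (fstᵛ-combine g h)) (sym (fstᵛ-combine g′ h)) e
    , trans (sndᵛ-combine g h) (sym (sndᵛ-combine g′ h))))

  combine-edgeʳ : ∀ g {h h′} → Edge H h h′ → Edge (G □ H) (combine g h) (combine g h′)
  combine-edgeʳ g {h} {h′} e = Equivalence.from (□-edge _ _) (inj₂
    ( trans (fstᵛ-combine g h) (sym (fstᵛ-combine g h′))
    , subst₂ (Edge H) (sym (sndᵛ-combine g h)) (sym (sndᵛ-combine g h′)) e))

  infix 6 _ʷ×_ _×ʷ_

  _ʷ×_ : ∀ {g g′} → Walk G g g′ → ∀ h → Walk (G □ H) (combine g h) (combine g′ h)
  P ʷ× h = mapʷ (λ g → combine g h) (combine-edgeˡ h) P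

  _×ʷ_ : ∀ g {h h′} → Walk H h h′ → Walk (G □ H) (combine g h) (combine g h′)
  g ×ʷ Q = mapʷ (combine g) (combine-edgeʳ g) Q

  -- The endpoints are given up to equality, so that a step in the other factor needs no transport.
  projᴳ : ∀ {i j g g′} → Walk (G □ H) i j → fstᵛ i ≡ g → fstᵛ j ≡ g′ → Walk G g g′
  projᴳ []      refl refl = []
  projᴳ (e ∷ W) refl j≡ with Equivalence.to (□-edge _ _) e
  ... | inj₁ (eᴳ , _) = eᴳ ∷ projᴳ W refl j≡
  ... | inj₂ (≡ᴳ , _) = projᴳ W (sym ≡ᴳ) j≡

  projᴴ : ∀ {i j h h′} → Walk (G □ H) i j → sndᵛ i ≡ h → sndᵛ j ≡ h′ → Walk H h h′
  projᴴ []      refl refl = []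
  projᴴ (e ∷ W) refl j≡ with Equivalence.to (□-edge _ _) e
  ... | inj₁ (_ , ≡ᴴ) = projᴴ W (sym ≡ᴴ) j≡
  ... | inj₂ (_ , eᴴ) = eᴴ ∷ projᴴ W refl j≡

  length-proj : ∀ {i j g g′ h h′} (W : Walk (G □ H) i j)
                (i≡g : fstᵛ i ≡ g) (j≡g′ : fstᵛ j ≡ g′)
                (i≡h : sndᵛ i ≡ h) (j≡h′ : sndᵛ j ≡ h′) →
                walkLength W ≡ walkLength (projᴳ W i≡g j≡g′) + walkLength (projᴴ W i≡h j≡h′)
  length-proj []      refl refl refl refl = refl
  length-proj (e ∷ W) refl j≡g′ refl j≡h′ with Equivalence.to (□-edge _ _) e
  ... | inj₁ (_ , ≡ᴴ) = cong suc (length-proj W refl j≡g′ (sym ≡ᴴ) j≡h′)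
  ... | inj₂ (≡ᴳ , _) = trans (cong suc (length-proj W (sym ≡ᴳ) j≡g′ refl j≡h′)) (sym (+-suc _ _))

  length-projᴳ≡0⇒fstᵛ≡ : ∀ {i j g g′ u} (W : Walk (G □ H) i j)
                         (i≡g : fstᵛ i ≡ g) (j≡g′ : fstᵛ j ≡ g′) →
                         walkLength (projᴳ W i≡g j≡g′) ≡ 0 → u ∈ₗ walkVertices W → fstᵛ u ≡ g
  length-projᴳ≡0⇒fstᵛ≡ []      refl refl _ (here refl) = refl
  length-projᴳ≡0⇒fstᵛ≡ (e ∷ W) refl j≡g′ length≡0 u∈ with Equivalence.to (□-edge _ _) e | u∈
  ... | inj₁ _        | _         = ⊥-elim (1+n≢0 length≡0)
  ... | inj₂ _        | here refl = refl
  ... | inj₂ (≡ᴳ , _) | there u∈W = length-projᴳ≡0⇒fstᵛ≡ W (sym ≡ᴳ) j≡g′ length≡0 u∈W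

  ∈-projᴴ⁻ : ∀ {i j h h′ v} (W : Walk (G □ H) i j) (i≡h : sndᵛ i ≡ h) (j≡h′ : sndᵛ j ≡ h′) →
             v ∈ₗ walkVertices (projᴴ W i≡h j≡h′) → ∃ λ u → u ∈ₗ walkVertices W × sndᵛ u ≡ v
  ∈-projᴴ⁻ []      refl refl (here refl) = _ , here refl , refl
  ∈-projᴴ⁻ (e ∷ W) refl j≡h′ v∈ with Equivalence.to (□-edge _ _) e | v∈
  ... | inj₁ (_ , ≡ᴴ) | v∈′       = map₂ (map₁ there) (∈-projᴴ⁻ W (sym ≡ᴴ) j≡h′ v∈′)
  ... | inj₂ _        | here refl = _ , here refl , refl
  ... | inj₂ _        | there v∈′ = map₂ (map₁ there) (∈-projᴴ⁻ W refl j≡h′ v∈′)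

  shortest-□-length : ∀ {g g′ h h′} {P : Walk G g g′} {Q : Walk H h h′} → IsShortest P → IsShortest Q →
                      (W : Walk (G □ H) (combine g h) (combine g′ h′)) → walkLength P + walkLength Q ≤ walkLength W
  shortest-□-length {g} {g′} {h} {h′} P-shortest Q-shortest W =
    subst (_ ≤_) (sym (length-proj W _ _ _ _)) (+-mono-≤ (P-shortest A) (Q-shortest B))
    where
    A : Walk G g g′
    A = projᴳ W (fstᵛ-combine g h) (fstᵛ-combine g′ h′)
    B : Walk H h h′
    B = projᴴ W (sndᵛ-combine g h) (sndᵛ-combine g′ h′)

  layer-isTotalMutualVisibility : ∀ {Z} → IsTotalMutualVisibility (G □ H) Z →
                                  ∀ g → IsTotalMutualVisibility H (layer Z g)
  layer-isTotalMutualVisibility {Z} Z-tmv g h h′ with Z-tmv (combine g h) (combine g h′)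
  ... | W , W-shortest , W-avoids = B , B-shortest , B-avoids
    where
    A : Walk G g g
    A = projᴳ W (fstᵛ-combine g h) (fstᵛ-combine g h′)
    B : Walk H h h′
    B = projᴴ W (sndᵛ-combine g h) (sndᵛ-combine g h′)
    W≤ : ∀ Q → walkLength A + walkLength B ≤ walkLength Q
    W≤ Q = subst₂ _≤_ (length-proj W _ _ _ _) (length-mapʷ (combine g) (combine-edgeʳ g) Q)
             (W-shortest (g ×ʷ Q))
    B-shortest : IsShortest B
    B-shortest Q = ≤-trans (m≤n+m (walkLength B) (walkLength A)) (W≤ Q)
    A≡0 : walkLength A ≡ 0
    A≡0 = n≤0⇒n≡0 (+-cancelʳ-≤ (walkLength B) (walkLength A) 0 (W≤ B))
    B-avoids : InteriorAvoids H (layer Z g) B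
    B-avoids v v∈B v∈layer with ∈-projᴴ⁻ W _ _ v∈B
    ... | u , u∈W , u≡v with W-avoids u u∈W (subst (_∈ Z) (sym u≡gv) (∈-preimage⁻ (combine g) Z v∈layer))
      where
      u≡gv : u ≡ combine g v
      u≡gv = trans (sym (combine-fstᵛ-sndᵛ u))
                   (cong₂ combine (length-projᴳ≡0⇒fstᵛ≡ W _ _ A≡0 u∈W) u≡v)
    ... | inj₁ u≡gh  = inj₁ (trans (sym u≡v) (trans (cong sndᵛ u≡gh) (sndᵛ-combine g h)))
    ... | inj₂ u≡gh′ = inj₂ (trans (sym u≡v) (trans (cong sndᵛ u≡gh′) (sndᵛ-combine g h′)))

  visible-×ˢ : ∀ {X Y g g′ h h′} → IsIndependent H Y → Visible G X g g′ → Visible H Y h h′ →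
               Visible (G □ H) (X ×ˢ Y) (combine g h) (combine g′ h′)
  visible-×ˢ {X} {Y} {g} {g′} {h} {h′} Y-independent (P , P-shortest , P-avoids) (Q , Q-shortest , Q-avoids) =
    W , W-shortest , W-avoids
    where
    open Split (split-shortest Y-independent Q-shortest Q-avoids)

    W : Walk (G □ H) (combine g h) (combine g′ h′)
    W = g ×ʷ front ++ʷ P ʷ× middle ++ʷ g′ ×ʷ back

    length-W : walkLength W ≡ walkLength P + walkLength Q
    length-W = begin
      walkLength W
        ≡⟨ length-++ʷ (g ×ʷ front) _ ⟩
      walkLength (g ×ʷ front) + walkLength (P ʷ× middle ++ʷ g′ ×ʷ back)
        ≡⟨ cong₂ _+_ (length-mapʷ _ _ front)
             (trans (length-++ʷ (P ʷ× middle) _) (cong₂ _+_ (length-mapʷ _ _ P) (length-mapʷ _ _ back))) ⟩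
      walkLength front + (walkLength P + walkLength back)
        ≡⟨ x∙yz≈y∙xz (walkLength front) (walkLength P) (walkLength back) ⟩
      walkLength P + (walkLength front + walkLength back)
        ≡⟨ cong (walkLength P +_) length-split ⟩
      walkLength P + walkLength Q ∎
      where open ≡-Reasoning

    W-shortest : IsShortest W
    W-shortest W′ = subst (_≤ walkLength W′) (sym length-W) (shortest-□-length P-shortest Q-shortest W′)

    W-avoids : InteriorAvoids (G □ H) (X ×ˢ Y) W
    W-avoids v v∈W v∈X×Y with ∈-++ʷ⁻ (g ×ʷ front) _ v∈W
    ... | inj₁ v∈front with ∈-mapʷ⁻ _ _ front v∈front
    ... | u , u∈front , refl = inj₁ (cong (combine g) (front-avoids u u∈front (proj₂ (∈-×ˢ⁻ X Y v∈X×Y))))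
    W-avoids v v∈W v∈X×Y | inj₂ v∈rest with ∈-++ʷ⁻ (P ʷ× middle) _ v∈rest
    ... | inj₂ v∈back with ∈-mapʷ⁻ _ _ back v∈back
    ... | u , u∈back , refl = inj₂ (cong (combine g′) (back-avoids u u∈back (proj₂ (∈-×ˢ⁻ X Y v∈X×Y))))
    W-avoids v v∈W v∈X×Y | inj₂ v∈rest | inj₁ v∈P with ∈-mapʷ⁻ _ _ P v∈P
    ... | p , p∈P , refl with ∈-×ˢ⁻ X Y v∈X×Y
    ... | p∈X , middle∈Y with P-avoids p p∈P p∈X
    ... | inj₁ refl = inj₁ (cong (combine g) (front-avoids middle (end∈ front) middle∈Y))
    ... | inj₂ refl = inj₂ (cong (combine g′) (back-avoids middle (start∈ back) middle∈Y))

  ×ˢ-isTotalMutualVisibility : ∀ {X Y} → IsTotalMutualVisibility G X → IsTotalMutualVisibility H Y →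
                               IsIndependent H Y → IsTotalMutualVisibility (G □ H) (X ×ˢ Y)
  ×ˢ-isTotalMutualVisibility X-tmv Y-tmv Y-independent i j =
    subst₂ (Visible (G □ H) _) (combine-fstᵛ-sndᵛ i) (combine-fstᵛ-sndᵛ j)
      (visible-×ˢ Y-independent (X-tmv (fstᵛ i) (fstᵛ j)) (Y-tmv (sndᵛ i) (sndᵛ j)))

  ∣totalMutualVisibility∣≤ : ∀ {Z tH} → (∀ Y → IsTotalMutualVisibility H Y → ∣ Y ∣ ≤ tH) →
                             IsTotalMutualVisibility (G □ H) Z → ∣ Z ∣ ≤ n G * tH
  ∣totalMutualVisibility∣≤ {Z} Y-bound Z-tmv =
    subst (_≤ _) (sym (∣p∣≡∑∣layer∣ (n G) Z))
      (∑-≤-* (n G) (∣_∣ ∘ layer Z) (λ g → Y-bound (layer Z g) (layer-isTotalMutualVisibility Z-tmv g)))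

swapᵛ : ∀ G H → Vertex (G □ H) → Vertex (H □ G)
swapᵛ G H i = combine (sndᵛ G H i) (fstᵛ G H i)

swapᵛ-edge : ∀ G H {i j} → Edge (G □ H) i j → Edge (H □ G) (swapᵛ G H i) (swapᵛ G H j)
swapᵛ-edge G H {i} {j} e =
  Equivalence.from (□-edge H G _ _) (swap-ProductEdge (Equivalence.to (□-edge G H i j) e))
  where
  swap-ProductEdge : ProductEdge G H i j → ProductEdge H G (swapᵛ G H i) (swapᵛ G H j)
  swap-ProductEdge (inj₁ (eᴳ , ≡ᴴ)) = inj₂
    ( trans (fstᵛ-combine H G _ _) (trans ≡ᴴ (sym (fstᵛ-combine H G _ _)))
    , subst₂ (Edge G) (sym (sndᵛ-combine H G _ _)) (sym (sndᵛ-combine H G _ _)) eᴳ)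
  swap-ProductEdge (inj₂ (≡ᴳ , eᴴ)) = inj₁
    ( subst₂ (Edge H) (sym (fstᵛ-combine H G _ _)) (sym (fstᵛ-combine H G _ _)) eᴴ
    , trans (sndᵛ-combine H G _ _) (trans ≡ᴳ (sym (sndᵛ-combine H G _ _))))

swapᵛ-involutive : ∀ G H i → swapᵛ H G (swapᵛ G H i) ≡ i
swapᵛ-involutive G H i =
  trans (cong₂ combine (sndᵛ-combine H G (sndᵛ G H i) (fstᵛ G H i))
                       (fstᵛ-combine H G (sndᵛ G H i) (fstᵛ G H i)))
        (combine-fstᵛ-sndᵛ G H i)

swapᵛ-permutation : ∀ G H → Permutation (n G * n H) (n H * n G)
swapᵛ-permutation G H =
  ↔-trans (*↔× {n G} {n H}) (↔-trans (×-comm (Fin (n G)) (Fin (n H))) (↔-sym (*↔× {n H} {n G})))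

isTotalMutualVisibility-□-comm : ∀ G H {Z} → IsTotalMutualVisibility (H □ G) Z →
                                 IsTotalMutualVisibility (G □ H) (preimage (swapᵛ G H) Z)
isTotalMutualVisibility-□-comm G H =
  isTotalMutualVisibility-preimage (swapᵛ H G) (swapᵛ-edge H G) (swapᵛ G H) (swapᵛ-edge G H)
    (swapᵛ-involutive H G) (swapᵛ-involutive G H)

∣preimage-swapᵛ∣ : ∀ G H (Z : Subset (n H * n G)) → ∣ preimage (swapᵛ G H) Z ∣ ≡ ∣ Z ∣
∣preimage-swapᵛ∣ G H = ∣preimage∣ (swapᵛ-permutation G H)

isMuT-□-comm : ∀ G H {t} → IsMuT (G □ H) t → IsMuT (H □ G) t
isMuT-□-comm G H ((Z , Z-tmv , ∣Z∣≡t) , maximal) =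
  ( preimage (swapᵛ H G) Z
  , isTotalMutualVisibility-□-comm H G Z-tmv
  , trans (∣preimage-swapᵛ∣ H G Z) ∣Z∣≡t) ,
  λ X X-tmv → subst (_≤ _) (∣preimage-swapᵛ∣ G H X) (maximal _ (isTotalMutualVisibility-□-comm G H X-tmv))

μt*μit≤μt-□ : ∀ G H {tG iH t} → IsMuT G tG → IsMuIt H iH → IsMuT (G □ H) t → tG * iH ≤ t
μt*μit≤μt-□ G H ((X , X-tmv , ∣X∣≡tG) , _) ((Y , Y-tmv , Y-independent , ∣Y∣≡iH) , _) (_ , maximal) =
  subst (_≤ _) (trans (∣p×ˢq∣ X Y) (cong₂ _*_ ∣X∣≡tG ∣Y∣≡iH))
    (maximal (X ×ˢ Y) (×ˢ-isTotalMutualVisibility G H X-tmv Y-tmv Y-independent))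

μt-□≤order*μt : ∀ G H {tH t} → IsMuT H tH → IsMuT (G □ H) t → t ≤ n G * tH
μt-□≤order*μt G H (_ , maximal) ((Z , Z-tmv , ∣Z∣≡t) , _) =
  subst (_≤ _) ∣Z∣≡t (∣totalMutualVisibility∣≤ G H maximal Z-tmv)

theorem4p1 : (G H : Graph) → IsSimple G → IsSimple H → Connected G → Connected H →
    2 ≤ order G → 2 ≤ order H →
    (tG tH iG iH tGH : ℕ) →
    IsMuT G tG → IsMuT H tH → IsMuIt G iG → IsMuIt H iH → IsMuT (G □ H) tGH →
    1 ≤ iG → 1 ≤ iH →
    ((iH * tG) ⊔ (iG * tH)) ≤ tGH × tGH ≤ ((tG * order H) ⊓ (tH * order G))
theorem4p1 G H _ _ _ _ _ _ tG tH iG iH tGH μtG μtH μitG μitH μtGH _ _ =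
  ⊔-lub (subst (_≤ tGH) (*-comm tG iH) (μt*μit≤μt-□ G H μtG μitH μtGH))
        (subst (_≤ tGH) (*-comm tH iG) (μt*μit≤μt-□ H G μtH μitG μtHG)) ,
  ⊓-glb (subst (tGH ≤_) (*-comm (n H) tG) (μt-□≤order*μt H G μtG μtHG))
        (subst (tGH ≤_) (*-comm (n G) tH) (μt-□≤order*μt G H μtH μtGH))
  where
  μtHG : IsMuT (H □ G) tGH
  μtHG = isMuT-□-comm G H μtGH
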